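{- Let $p$ be a prime, $t$ a positive integer with $t<\sqrt p$, and let $A\subseteq\mathbb{F}_p$ be a non-averaging set of order $t$. Then $|A|\ll p/t^{2/3}$, with an absolute implied constant.
   Context: A set $A\subseteq\mathbb{F}_p$ is non-averaging of order $t$ if for all integers $1\le m,n\le t$, the equation $mX_1+nX_2=(m+n)X_3$ has no solutions $(X_1,X_2,X_3)\in A^3$ in $\mathbb{F}_p$ other than the trivial ones $X_1=X_2=X_3$. -}

module Defs where

open import Data.Nat using (ℕ; _+_; _*_; _%_; _≤_; NonZero)
open import Data.Fin using (Fin; toℕ)
open import Data.Fin.Subset using (Subset; _∈_)
open import Data.Product using (_×_)
open import Relation.Binary.PropositionalEquality using (_≡_)

NonAveraging : (p : ℕ) .{{_ : NonZero p}} → ℕ → Subset p → Set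
NonAveraging p t A =
  ∀ (m n : ℕ) → 1 ≤ m → m ≤ t → 1 ≤ n → n ≤ t →
  ∀ (x₁ x₂ x₃ : Fin p) → x₁ ∈ A → x₂ ∈ A → x₃ ∈ A →
  (m * toℕ x₁ + n * toℕ x₂) % p ≡ ((m + n) * toℕ x₃) % p →
  (x₁ ≡ x₂) × (x₂ ≡ x₃)

{-# OPTIONS --safe #-}
module Submission where

-- Read the residues as integers 0, …, p − 1. If i < j < k lie in A with k − i ≤ t, then
-- (k − j) i + (j − i) k = (k − i) j is an averaging relation with coefficients in [1, t];
-- so every t + 1 consecutive integers contain at most two elements of A. Covering [0, p)
-- by ⌈p / (t + 1)⌉ such windows gives |A| t ≤ 4 p, which is stronger than the claim.

open import Defs
open import Data.Nat using (ℕ; zero; suc; _+_; _*_; _^_; _/_; _%_; _≤_; _<_; z≤n; s≤s; NonZero; >-nonZero)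
open import Data.Nat.Properties
open import Data.Nat.DivMod using (m≡m%n+[m/n]*n; m%n<n)
open import Data.Nat.Primality using (Prime)
open import Data.Nat.Solver using (module +-*-Solver)
open import Data.Bool using (Bool; true; false; if_then_else_)
open import Data.Fin using (toℕ) renaming (zero to fzero; suc to fsuc)
open import Data.Fin.Subset using (Subset; ∣_∣; _∈_)
open import Data.Vec using ([]; _∷_; here; there)
open import Data.Product using (Σ; ∃; _×_; _,_; proj₁)
open import Data.Empty using (⊥; ⊥-elim)
open import Relation.Binary.PropositionalEquality using (_≡_; refl; sym; trans; cong; subst)

open +-*-Solver

count : (ℕ → Bool) → ℕ → ℕ → ℕ
count f a zero    = 0
count f a (suc L) = if f a then suc (count f (suc a) L) else count f (suc a) L

count-+ : ∀ f a L₁ L₂ → count f a (L₁ + L₂) ≡ count f a L₁ + count f (a + L₁) L₂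
count-+ f a zero    L₂ rewrite +-identityʳ a = refl
count-+ f a (suc L₁) L₂ rewrite +-suc a L₁ with f a
... | true  = cong suc (count-+ f (suc a) L₁ L₂)
... | false = count-+ f (suc a) L₁ L₂

count-suc : ∀ f a L → count f (suc a) L ≡ count (λ k → f (suc k)) a L
count-suc f a zero = refl
count-suc f a (suc L) with f (suc a)
... | true  = cong suc (count-suc f (suc a) L)
... | false = count-suc f (suc a) L

NoCloseTriple : (ℕ → Bool) → ℕ → Set
NoCloseTriple f t =
  ∀ {i j k} → i < j → j < k → k ≤ i + t → f i ≡ true → f j ≡ true → f k ≡ true → ⊥

window-tail : ∀ {a L b} → a + suc L ≤ b → suc a + L ≤ b
window-tail {a} {L} {b} = subst (_≤ b) (+-suc a L)

window-head : ∀ {a L b} → a + suc L ≤ suc b → a ≤ b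
window-head {a} {L} le = ≤-pred (≤-trans (s≤s (m≤m+n a L)) (window-tail le))

module _ {f : ℕ → Bool} {t : ℕ} (noTriple : NoCloseTriple f t) where

  count-after-two : ∀ {i j a} L → i < j → j < a → a + L ≤ suc (i + t) →
                    f i ≡ true → f j ≡ true → count f a L ≡ 0
  count-after-two zero _ _ _ _ _ = refl
  count-after-two {a = a} (suc L) i<j j<a le fi fj with f a in fa
  ... | true  = ⊥-elim (noTriple i<j j<a (window-head le) fi fj fa)
  ... | false = count-after-two L i<j (m<n⇒m<1+n j<a) (window-tail le) fi fj

  count-after-one : ∀ {i a} L → i < a → a + L ≤ suc (i + t) → f i ≡ true → count f a L ≤ 1
  count-after-one zero _ _ _ = z≤n
  count-after-one {a = a} (suc L) i<a le fi with f a in fa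
  ... | true  = s≤s (≤-reflexive (count-after-two L i<a ≤-refl (window-tail le) fi fa))
  ... | false = count-after-one L (m<n⇒m<1+n i<a) (window-tail le) fi

  count-window : ∀ a L → L ≤ suc t → count f a L ≤ 2
  count-window a zero    _  = z≤n
  count-window a (suc L) le with f a in fa
  ... | true  = s≤s (count-after-one L ≤-refl (s≤s (+-monoʳ-≤ a (≤-pred le))) fa)
  ... | false = count-window (suc a) L (≤-trans (n≤1+n L) le)

  count-windows : ∀ a q → count f a (q * suc t) ≤ 2 * q
  count-windows a zero    = z≤n
  count-windows a (suc q) = begin
    count f a (suc t + q * suc t)                     ≡⟨ count-+ f a (suc t) (q * suc t) ⟩
    count f a (suc t) + count f (a + suc t) (q * suc t) ≤⟨ +-mono-≤ (count-window a (suc t) ≤-refl)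
                                                                   (count-windows (a + suc t) q) ⟩
    2 + 2 * q                                         ≡⟨ sym (*-suc 2 q) ⟩
    2 * suc q                                         ∎
    where open ≤-Reasoning

  count-≤ : ∀ n → count f 0 n * suc t ≤ 2 * n + 2 * suc t
  count-≤ n = begin
    count f 0 n * T                           ≡⟨ cong (λ m → count f 0 m * T) n≡qT+r ⟩
    count f 0 (q * T + r) * T                 ≡⟨ cong (_* T) (count-+ f 0 (q * T) r) ⟩
    (count f 0 (q * T) + count f (q * T) r) * T ≤⟨ *-monoˡ-≤ T (+-mono-≤ (count-windows 0 q)
                                                    (count-window (q * T) r (<⇒≤ (m%n<n n T)))) ⟩
    (2 * q + 2) * T                           ≡⟨ solve 2 (λ q T → (con 2 :* q :+ con 2) :* T
                                                   := con 2 :* (q :* T) :+ con 2 :* T) refl q T ⟩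
    2 * (q * T) + 2 * T                       ≤⟨ +-monoˡ-≤ (2 * T) (*-monoʳ-≤ 2 qT≤n) ⟩
    2 * n + 2 * T                             ∎
    where
    open ≤-Reasoning
    T = suc t
    q = n / T
    r = n % T
    n≡qT+r : n ≡ q * T + r
    n≡qT+r = trans (m≡m%n+[m/n]*n n T) (+-comm r (q * T))
    qT≤n : q * T ≤ n
    qT≤n = subst (q * T ≤_) (sym n≡qT+r) (m≤m+n (q * T) r)

_∋ᵇ_ : ∀ {n} → Subset n → ℕ → Bool
[]      ∋ᵇ k     = false
(b ∷ A) ∋ᵇ zero  = b
(b ∷ A) ∋ᵇ suc k = A ∋ᵇ k

∋ᵇ-sound : ∀ {n} (A : Subset n) k → A ∋ᵇ k ≡ true → ∃ λ x → toℕ x ≡ k × x ∈ A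
∋ᵇ-sound (true ∷ A) zero    refl = fzero , refl , here
∋ᵇ-sound (b ∷ A)    (suc k) Ak with x , refl , x∈A ← ∋ᵇ-sound A k Ak = fsuc x , refl , there x∈A

∣∣≡count : ∀ {n} (A : Subset n) → ∣ A ∣ ≡ count (A ∋ᵇ_) 0 n
∣∣≡count []                = refl
∣∣≡count {suc n} (true ∷ A)  = cong suc (trans (∣∣≡count A) (sym (count-suc ((true ∷ A) ∋ᵇ_) 0 n)))
∣∣≡count {suc n} (false ∷ A) = trans (∣∣≡count A) (sym (count-suc ((false ∷ A) ∋ᵇ_) 0 n))

averaging-identity : ∀ i a b → suc b * i + suc a * (suc (suc i + a) + b) ≡ (suc b + suc a) * (suc i + a)
averaging-identity = solve 3 (λ i a b → (con 1 :+ b) :* i :+ (con 1 :+ a) :* (con 1 :+ (con 1 :+ i :+ a) :+ b)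
                                      := (con 1 :+ b :+ (con 1 :+ a)) :* (con 1 :+ i :+ a)) refl

gaps≤t : ∀ i a b t → suc (suc i + a) + b ≤ i + t → suc a + suc b ≤ t
gaps≤t i a b t le = +-cancelˡ-≤ i _ _ (subst (_≤ i + t) k≡i+gaps le)
  where
  k≡i+gaps : suc (suc i + a) + b ≡ i + (suc a + suc b)
  k≡i+gaps = solve 3 (λ i a b → con 1 :+ (con 1 :+ i :+ a) :+ b := i :+ (con 1 :+ a :+ (con 1 :+ b))) refl i a b

nonAveraging⇒noCloseTriple : ∀ {p} .{{_ : NonZero p}} {t} (A : Subset p) →
                             NonAveraging p t A → NoCloseTriple (A ∋ᵇ_) t
nonAveraging⇒noCloseTriple {p} {t} A nonAvg {i} i<j j<k k≤i+t Ai Aj Ak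
  with a , refl ← m≤n⇒∃[o]m+o≡n i<j
     | b , refl ← m≤n⇒∃[o]m+o≡n j<k
     | x , refl , x∈A ← ∋ᵇ-sound A _ Ai
     | y , y≡j , y∈A ← ∋ᵇ-sound A _ Aj
     | z , z≡k , z∈A ← ∋ᵇ-sound A _ Ak
  = <-irrefl (cong toℕ x≡z) (subst (toℕ x <_) (sym z≡k) (<-trans i<j j<k))
  where
  gaps = gaps≤t (toℕ x) a b t k≤i+t
  relation : (suc b * toℕ x + suc a * toℕ z) % p ≡ ((suc b + suc a) * toℕ y) % p
  relation rewrite y≡j | z≡k = cong (_% p) (averaging-identity (toℕ x) a b)
  x≡z : x ≡ z
  x≡z = proj₁ (nonAvg (suc b) (suc a) (s≤s z≤n) (≤-trans (m≤n+m (suc b) (suc a)) gaps)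
                      (s≤s z≤n) (≤-trans (m≤m+n (suc a) (suc b)) gaps) x z y x∈A z∈A y∈A relation)

nonAveraging⇒∣∣*t≤4p : ∀ {p} .{{_ : NonZero p}} {t} (A : Subset p) →
                       NonAveraging p t A → suc t ≤ p → ∣ A ∣ * t ≤ 4 * p
nonAveraging⇒∣∣*t≤4p {p} {t} A nonAvg T≤p = begin
  ∣ A ∣ * t                      ≤⟨ *-monoʳ-≤ ∣ A ∣ (n≤1+n t) ⟩
  ∣ A ∣ * suc t                  ≡⟨ cong (_* suc t) (∣∣≡count A) ⟩
  count (A ∋ᵇ_) 0 p * suc t      ≤⟨ count-≤ (nonAveraging⇒noCloseTriple A nonAvg) p ⟩
  2 * p + 2 * suc t              ≤⟨ +-monoʳ-≤ (2 * p) (*-monoʳ-≤ 2 T≤p) ⟩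
  2 * p + 2 * p                  ≡⟨ solve 1 (λ p → con 2 :* p :+ con 2 :* p := con 4 :* p) refl p ⟩
  4 * p                          ∎
  where open ≤-Reasoning

cube-bound : ∀ c t m → c * t ≤ m → c ^ 3 * t ^ 2 ≤ m ^ 3
cube-bound c zero    m _  = ≤-trans (≤-reflexive (*-zeroʳ (c ^ 3))) z≤n
cube-bound c t@(suc _) m ct≤m = begin
  c ^ 3 * t ^ 2 ≤⟨ *-monoʳ-≤ (c ^ 3) (^-monoʳ-≤ t (n≤1+n 2)) ⟩
  c ^ 3 * t ^ 3 ≡⟨ solve 2 (λ c t → c :^ 3 :* t :^ 3 := (c :* t) :^ 3) refl c t ⟩
  (c * t) ^ 3   ≤⟨ ^-monoˡ-≤ 3 ct≤m ⟩
  m ^ 3         ∎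
  where open ≤-Reasoning

theorem34 : Σ ℕ (λ C → ∀ (p : ℕ) .{{_ : NonZero p}} → Prime p →
              ∀ (t : ℕ) → 1 ≤ t → t * t < p →
              ∀ (A : Subset p) → NonAveraging p t A →
              ∣ A ∣ ^ 3 * t ^ 2 ≤ C * p ^ 3)
theorem34 = 64 , λ p _ t 1≤t t*t<p A nonAvg →
  let t+1≤p = ≤-trans (s≤s (m≤m*n t t {{>-nonZero 1≤t}})) t*t<p
  in ≤-trans (cube-bound ∣ A ∣ t (4 * p) (nonAveraging⇒∣∣*t≤4p A nonAvg t+1≤p))
             (≤-reflexive (solve 1 (λ p → (con 4 :* p) :^ 3 := con 64 :* p :^ 3) refl p))
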